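{- Let $q\in\{1,2,3\}$ and let $(G_k)_{k\ge0}$ be defined by $G_0=\dots=G_{q-2}=0$, $G_{q-1}=1$, $G_{k+q}=G_{k+q-1}+G_k$ ($k\ge0$). In the game described below, starting from a heap of $n\ge1$ beans, the first player has a winning strategy if and only if $n$ is not a $G$ number (i.e., $n\ne G_k$ for all $k$); moreover, when $n$ is not a $G$ number, the first player wins by removing, every time it is his turn to play, a number of beans equal to the least $G$-summand of the number of beans left in the heap.
   Context: Every integer $m\ge1$ has a unique representation $m=\sum_{i\ge0}\epsilon_i G_{2q-2+i}$ with $\epsilon_i\in\{0,1\}$ and $\epsilon_i+\dots+\epsilon_{i+q-1}\le1$ for all $i$; the $G$-summands of $m$ are the terms $G_{2q-2+i}$ with $\epsilon_i=1$, and the least $G$-summand is the smallest of them. The game: a single heap of beans; two players alternately remove a positive number of beans; on the first move any number may be removed except the whole heap; if a player has just removed $p$ beans, the next player may remove $p'$ beans with $p'\le qp$ if $p=1$ or if $q\in\{1,2\}$, and $p'\le qp-1$ if $p\ge2$ and $q=3$. The player removing the last bean wins (a player unable to move loses). -}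

module Defs where

open import Data.Nat using (ℕ; zero; suc; _+_; _*_; _∸_; _≤_; _<_)
open import Data.Bool using (Bool; true; false)
open import Data.Product using (Σ; ∃; _×_; _,_)
open import Relation.Binary.PropositionalEquality using (_≡_)

G₁ : ℕ → ℕ
G₁ zero    = 1
G₁ (suc k) = G₁ k + G₁ k

G₂ : ℕ → ℕ
G₂ zero          = 0
G₂ (suc zero)    = 1
G₂ (suc (suc k)) = G₂ (suc k) + G₂ k

G₃ : ℕ → ℕ
G₃ zero                = 0
G₃ (suc zero)          = 0
G₃ (suc (suc zero))    = 1
G₃ (suc (suc (suc k))) = G₃ (suc (suc k)) + G₃ k

-- G q k; only meaningful for q ∈ {1,2,3} (junk value 0 otherwise).
G : ℕ → ℕ → ℕ
G 1 k = G₁ k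
G 2 k = G₂ k
G 3 k = G₃ k
G _ k = 0

IsGNumber : ℕ → ℕ → Set
IsGNumber q n = ∃ λ k → G q k ≡ n

bit : Bool → ℕ
bit true  = 1
bit false = 0

sumBelow : ℕ → (ℕ → ℕ) → ℕ
sumBelow zero    f = 0
sumBelow (suc L) f = sumBelow L f + f L

window : ℕ → (ℕ → Bool) → ℕ → ℕ
window q ε i = sumBelow q (λ j → bit (ε (i + j)))

IsGRep : ℕ → (ℕ → Bool) → ℕ → Set
IsGRep q ε m =
  Σ ℕ λ L →
    (∀ i → L ≤ i → ε i ≡ false) ×
    (∀ i → window q ε i ≤ 1) ×
    (sumBelow L (λ i → bit (ε i) * G q (q + q ∸ 2 + i)) ≡ m)

LeastGSummand : ℕ → ℕ → ℕ → Set
LeastGSummand q m s =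
  Σ (ℕ → Bool) λ ε → IsGRep q ε m ×
    (Σ ℕ λ i → (ε i ≡ true) × (∀ j → j < i → ε j ≡ false) × (s ≡ G q (q + q ∸ 2 + i)))

-- Maximal number of beans the next player may take after p beans were removed.
maxNext : ℕ → ℕ → ℕ
maxNext 3 (suc (suc p)) = 3 * suc (suc p) ∸ 1
maxNext q p = q * p

-- Positions: heap of m beans, player to move may remove between 1 and k beans (and at most m).
-- A player who cannot move (m = 0) loses.
data Win (q : ℕ) : ℕ → ℕ → Set
data Lose (q : ℕ) : ℕ → ℕ → Set

data Win q where
  win : ∀ {m k} p → 1 ≤ p → p ≤ k → p ≤ m → Lose q (m ∸ p) (maxNext q p) → Win q m k

data Lose q where
  lose : ∀ {m k} → (∀ p → 1 ≤ p → p ≤ k → p ≤ m → Win q (m ∸ p) (maxNext q p)) → Lose q m k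

-- First move: any number except the whole heap.
FirstPlayerWins : ℕ → ℕ → Set
FirstPlayerWins q n = Win q n (n ∸ 1)

data WinsByLeastSummand (q : ℕ) : ℕ → ℕ → Set where
  play : ∀ {m k} p → LeastGSummand q m p → 1 ≤ p → p ≤ k → p ≤ m →
         (∀ p' → 1 ≤ p' → p' ≤ maxNext q p → p' ≤ m ∸ p →
            WinsByLeastSummand q (m ∸ p ∸ p') (maxNext q p')) →
         WinsByLeastSummand q m k

module Submission where

-- Write d = q - 1 and H i = G_{2q-2+i} (i ≥ 0), so that H 0 = 1 and
-- H (i+1) = H i + H (i - d).  A "representation" of m is a sum of summands H i whose indices
-- are at least q apart; it encodes the digit sequence of the statement.
-- The central lemma (addBelow) says: if 1 ≤ m < H t and R is represented with indices
-- ≥ t + d, then m + R has a representation whose least summand H j satisfies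
-- m + H (j - d) ≤ H t.  Two consequences drive the game analysis:
--   * (respond) after the opponent removes p beans from a summand H i, the least summand H j
--     of what is left satisfies H (j - d) ≤ p, hence H j ≤ maxNext q p: the least summand may
--     again be taken;
--   * the opponent can never empty the heap, since maxNext q (H j) < H (q + j).
-- By well-founded induction on the heap, taking the least summand therefore wins from every
-- positive heap whose least summand is a legal move.  For a non-G number n the least summand is
-- not the whole heap, so it is a legal first move; a G number H i is lost for the player to move,
-- because every first move p < H i is answered by the strategy.

open import Defs
open import Data.Nat using (ℕ; zero; suc; _+_; _*_; _∸_; _≤_; _<_; z≤n; s≤s; _≟_; _<?_; _≤?_)
open import Data.Nat.Properties
open import Data.Nat.Induction using (<-rec)
open import Data.Bool using (Bool; true; false)
open import Data.Product using (Σ; _×_; _,_)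
open import Data.Sum using (inj₁; inj₂)
open import Data.Empty using (⊥; ⊥-elim)
open import Relation.Nullary using (¬_; yes; no)
open import Relation.Binary.PropositionalEquality
open import Function.Bundles using (_⇔_; mk⇔)
open import Algebra.Properties.CommutativeSemigroup +-commutativeSemigroup
  using (interchange; xy∙z≈y∙xz)

leastSummand⇒Win : ∀ {q m k} → WinsByLeastSummand q m k → Win q m k
leastSummand⇒Win (play p _ p≥1 p≤k p≤m next) =
  win p p≥1 p≤k p≤m (lose λ p' a b c → leastSummand⇒Win (next p' a b c))

Win-Lose-disjoint : ∀ {q m k} → Win q m k → Lose q m k → ⊥
Win-Lose-disjoint (win p a b c (lose replies)) (lose moves) with moves p a b c
... | win p' a' b' c' lost = Win-Lose-disjoint (replies p' a' b' c') lost

sumBelow-cong : ∀ L {f g : ℕ → ℕ} → (∀ x → f x ≡ g x) → sumBelow L f ≡ sumBelow L g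
sumBelow-cong zero    eq = refl
sumBelow-cong (suc L) eq = cong₂ _+_ (sumBelow-cong L eq) (eq L)

sumBelow-+ : ∀ L (f g : ℕ → ℕ) → sumBelow L (λ x → f x + g x) ≡ sumBelow L f + sumBelow L g
sumBelow-+ zero    f g = refl
sumBelow-+ (suc L) f g = trans (cong (_+ (f L + g L)) (sumBelow-+ L f g))
                               (interchange (sumBelow L f) (sumBelow L g) (f L) (g L))

sumBelow-zero : ∀ L (f : ℕ → ℕ) → (∀ x → x < L → f x ≡ 0) → sumBelow L f ≡ 0
sumBelow-zero zero    f vanish = refl
sumBelow-zero (suc L) f vanish =
  cong₂ _+_ (sumBelow-zero L f (λ x x<L → vanish x (m≤n⇒m≤1+n x<L))) (vanish L ≤-refl)

sumBelow-single : ∀ L (f : ℕ → ℕ) i → i < L → (∀ x → x ≢ i → f x ≡ 0) → sumBelow L f ≡ f i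
sumBelow-single (suc L) f i i<1+L vanish with m≤n⇒m<n∨m≡n (≤-pred i<1+L)
... | inj₁ i<L  = trans (cong₂ _+_ (sumBelow-single L f i i<L vanish) (vanish L (≢-sym (<⇒≢ i<L))))
                        (+-identityʳ (f i))
... | inj₂ refl = cong (_+ f i) (sumBelow-zero L f (λ x x<i → vanish x (<⇒≢ x<i)))

window≤1 : ∀ q (ε : ℕ → Bool) → (∀ a b → ε a ≡ true → ε b ≡ true → a < b → q + a ≤ b) →
           ∀ i → window q ε i ≤ 1
window≤1 q ε spaced i = prefix q ≤-refl
  where
  prefix : ∀ L → L ≤ q → sumBelow L (λ j → bit (ε (i + j))) ≤ 1
  prefix zero    _   = z≤n
  prefix (suc L) L<q with ε (i + L) in εL
  ... | false = ≤-trans (≤-reflexive (+-identityʳ _)) (prefix L (<⇒≤ L<q))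
  ... | true  = ≤-reflexive (cong (_+ 1) (sumBelow-zero L _ earlier))
    where
    earlier : ∀ j → j < L → bit (ε (i + j)) ≡ 0
    earlier j j<L with ε (i + j) in εj
    ... | false = refl
    ... | true  = ⊥-elim (<⇒≱ close (spaced (i + j) (i + L) εj εL (+-monoʳ-< i j<L)))
      where
      close : i + L < q + (i + j)
      close = begin-strict
        i + L       <⟨ +-monoʳ-< i L<q ⟩
        i + q       ≡⟨ +-comm i q ⟩
        q + i       ≤⟨ +-monoʳ-≤ q (m≤m+n i j) ⟩
        q + (i + j) ∎
        where open ≤-Reasoning

Summand : ℕ → ℕ → ℕ
Summand d i = G (suc d) (suc d + suc d ∸ 2 + i)

-- Growth of a sequence with H 0 = 1 and H (i+1) = H i + H (i - d): it is positive and strictly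
-- increasing.  (Kept apart from Hypotheses because the instances below use it to verify those.)
module Growth (d : ℕ)
  (recurrence : ∀ i → Summand d (suc i) ≡ Summand d i + Summand d (i ∸ d))
  (start : Summand d 0 ≡ 1)
  where

  H : ℕ → ℕ
  H = Summand d

  H-pos : ∀ i → 1 ≤ H i
  H-pos zero    = ≤-reflexive (sym start)
  H-pos (suc i) = ≤-trans (H-pos i) (≤-trans (m≤m+n _ _) (≤-reflexive (sym (recurrence i))))

  H-<-suc : ∀ i → H i < H (suc i)
  H-<-suc i = <-≤-trans (m<m+n (H i) (H-pos (i ∸ d))) (≤-reflexive (sym (recurrence i)))

  H-mono : ∀ {i j} → i ≤ j → H i ≤ H j
  H-mono {j = zero}  z≤n    = ≤-refl
  H-mono {j = suc j} i≤1+j with m≤n⇒m<n∨m≡n i≤1+j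
  ... | inj₁ i<1+j = ≤-trans (H-mono (≤-pred i<1+j)) (<⇒≤ (H-<-suc j))
  ... | inj₂ refl  = ≤-refl

  n<H : ∀ t → t < H t
  n<H zero    = H-pos 0
  n<H (suc t) = <-≤-trans (s≤s (n<H t)) (H-<-suc t)

record Hypotheses (d : ℕ) : Set where
  field
    recurrence : ∀ i → Summand d (suc i) ≡ Summand d i + Summand d (i ∸ d)
    start      : Summand d 0 ≡ 1
    -- after the least summand H j is removed, the reply cannot reach the next summand H (q + j)
    reply-short : ∀ j → maxNext (suc d) (Summand d j) < Summand d (suc d + j)
    -- a reply of H (j - d) beans allows taking H j
    reply-enough : ∀ j → Summand d j ≤ maxNext (suc d) (Summand d (j ∸ d))
    maxNext-mono : ∀ {a b} → a ≤ b → maxNext (suc d) a ≤ maxNext (suc d) b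
    G-summand : ∀ n → 1 ≤ n → IsGNumber (suc d) n → Σ ℕ λ i → Summand d i ≡ n

module Theory (d : ℕ) (hyp : Hypotheses d) where
  open Hypotheses hyp
  open Growth d recurrence start

  q : ℕ
  q = suc d

  data Rep (k : ℕ) : ℕ → Set where
    nil  : Rep k 0
    cons : ∀ {m} i → k ≤ i → Rep (q + i) m → Rep k (H i + m)

  Rep-weaken : ∀ {k k' m} → k' ≤ k → Rep k m → Rep k' m
  Rep-weaken k'≤k nil             = nil
  Rep-weaken k'≤k (cons i k≤i r) = cons i (≤-trans k'≤k k≤i) r

  RepWithLeast : ℕ → ℕ → Set
  RepWithLeast j m = Σ ℕ λ x → Rep (q + j) x × (m ≡ H j + x)

  AddBelow : ℕ → Set
  AddBelow t = ∀ m R → Rep (d + t) R → 1 ≤ m → m < H t →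
               Σ ℕ λ j → RepWithLeast j (m + R) × (m + H (j ∸ d) ≤ H t)

  -- The case m = H u + m' with m' < H (u - d) (so m < H (u + 1)): H u becomes a summand and m' is
  -- added below it, using the lemma for u - d.
  addBelow-top : ∀ u → AddBelow (u ∸ d) → ∀ m' R → Rep (q + u) R → m' < H (u ∸ d) →
                 Σ ℕ λ j → RepWithLeast j (H u + m' + R) × (H u + m' + H (j ∸ d) ≤ H (suc u))
  addBelow-top u _ zero R r _ =
    u , (R , r , cong (_+ R) (+-identityʳ (H u))) ,
    ≤-reflexive (trans (cong (_+ H (u ∸ d)) (+-identityʳ (H u))) (sym (recurrence u)))
  addBelow-top u ih (suc m') R r m'<H with d ≤? u
  ... | no d≰u = ⊥-elim (<⇒≱ (subst (suc m' <_) H[u∸d]≡1 m'<H) (s≤s z≤n))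
    where
    H[u∸d]≡1 : H (u ∸ d) ≡ 1
    H[u∸d]≡1 = trans (cong H (m≤n⇒m∸n≡0 (<⇒≤ (≰⇒> d≰u)))) start
  ... | yes d≤u with ih (suc m') (H u + R) (cons u (≤-reflexive (m+[n∸m]≡n d≤u)) r) (s≤s z≤n) m'<H
  ...   | j , rep , bound = j , subst (RepWithLeast j) (sym (xy∙z≈y∙xz (H u) (suc m') R)) rep , top-bound
    where
    open ≤-Reasoning
    top-bound : H u + suc m' + H (j ∸ d) ≤ H (suc u)
    top-bound = begin
      H u + suc m' + H (j ∸ d)   ≡⟨ +-assoc (H u) (suc m') _ ⟩
      H u + (suc m' + H (j ∸ d)) ≤⟨ +-monoʳ-≤ (H u) bound ⟩
      H u + H (u ∸ d)            ≡⟨ sym (recurrence u) ⟩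
      H (suc u)                  ∎

  -- Strong induction on t: either m < H (t - 1), or m = H (t - 1) + m' as in addBelow-top.
  addBelow-step : ∀ t → (∀ {t'} → t' < t → AddBelow t') → AddBelow t
  addBelow-step zero _ m R r m≥1 m<H0 = ⊥-elim (<⇒≱ m<H0 (≤-trans (≤-reflexive start) m≥1))
  addBelow-step (suc u) ih m R r m≥1 m<H with m <? H u
  ... | yes m<Hu with ih ≤-refl m R (Rep-weaken (+-monoʳ-≤ d (n≤1+n u)) r) m≥1 m<Hu
  ...   | j , rep , bound = j , rep , ≤-trans bound (<⇒≤ (H-<-suc u))
  addBelow-step (suc u) ih m R r m≥1 m<H | no m≮Hu =
    subst (λ m → Σ ℕ λ j → RepWithLeast j (m + R) × (m + H (j ∸ d) ≤ H (suc u)))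
          (m+[n∸m]≡n Hu≤m)
          (addBelow-top u (ih (s≤s (m∸n≤m u d))) (m ∸ H u) R (subst (λ k → Rep k R) (+-suc d u) r) rest<)
    where
    Hu≤m : H u ≤ m
    Hu≤m = ≮⇒≥ m≮Hu
    rest< : m ∸ H u < H (u ∸ d)
    rest< = +-cancelˡ-< (H u) _ _ (subst₂ _<_ (sym (m+[n∸m]≡n Hu≤m)) (recurrence u) m<H)

  addBelow : ∀ t → AddBelow t
  addBelow = <-rec AddBelow addBelow-step

  represent : ∀ m → 1 ≤ m → Σ ℕ λ j → RepWithLeast j m
  represent m m≥1 with addBelow m m 0 nil m≥1 (n<H m)
  ... | j , rep , _ = j , subst (RepWithLeast j) (+-identityʳ m) rep

  digits : ∀ {k m} → Rep k m → ℕ → Bool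
  digits nil          x = false
  digits (cons i _ r) x with x ≟ i
  ... | yes _ = true
  ... | no _  = digits r x

  digits-from : ∀ {k m} (r : Rep k m) x → digits r x ≡ true → k ≤ x
  digits-from (cons i k≤i r) x one with x ≟ i
  ... | yes refl = k≤i
  ... | no _     = ≤-trans k≤i (≤-trans (m≤n+m i q) (digits-from r x one))

  digits-below : ∀ {k m} (r : Rep k m) x → x < k → digits r x ≡ false
  digits-below r x x<k with digits r x in one
  ... | false = refl
  ... | true  = ⊥-elim (<⇒≱ x<k (digits-from r x one))

  digits-spaced : ∀ {k m} (r : Rep k m) a b → digits r a ≡ true → digits r b ≡ true → a < b → q + a ≤ b
  digits-spaced (cons i k≤i r) a b ra rb a<b with a ≟ i | b ≟ i
  ... | yes refl | yes refl = ⊥-elim (<-irrefl refl a<b)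
  ... | yes refl | no _     = digits-from r b rb
  ... | no _     | yes refl = ⊥-elim (<⇒≱ a<b (≤-trans (m≤n+m b q) (digits-from r a ra)))
  ... | no _     | no _     = digits-spaced r a b ra rb a<b

  support : ∀ {k m} → Rep k m → ℕ
  support nil          = 0
  support (cons i _ r) = suc i + support r

  digits-beyond : ∀ {k m} (r : Rep k m) x → support r ≤ x → digits r x ≡ false
  digits-beyond nil          x _ = refl
  digits-beyond (cons i _ r) x s≤x with x ≟ i
  ... | yes refl = ⊥-elim (<⇒≱ (m≤m+n (suc x) (support r)) s≤x)
  ... | no _     = digits-beyond r x (≤-trans (m≤n+m (support r) (suc i)) s≤x)

  only : ℕ → ℕ → ℕ
  only i x with x ≟ i
  ... | yes _ = H x
  ... | no _  = 0

  only-sum : ∀ i L → i < L → sumBelow L (only i) ≡ H i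
  only-sum i L i<L = trans (sumBelow-single L (only i) i i<L off) on
    where
    on : only i i ≡ H i
    on with i ≟ i
    ... | yes _  = refl
    ... | no i≢i = ⊥-elim (i≢i refl)
    off : ∀ x → x ≢ i → only i x ≡ 0
    off x x≢i with x ≟ i
    ... | yes x≡i = ⊥-elim (x≢i x≡i)
    ... | no _    = refl

  digits-value : ∀ {k m} (r : Rep k m) L → (∀ x → L ≤ x → digits r x ≡ false) →
                 sumBelow L (λ x → bit (digits r x) * H x) ≡ m
  digits-value nil L _ = sumBelow-zero L _ (λ _ _ → refl)
  digits-value (cons {m} i k≤i r) L beyond = begin
      sumBelow L (λ x → bit (digits (cons i k≤i r) x) * H x)
    ≡⟨ sumBelow-cong L split ⟩
      sumBelow L (λ x → only i x + bit (digits r x) * H x)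
    ≡⟨ sumBelow-+ L (only i) _ ⟩
      sumBelow L (only i) + sumBelow L (λ x → bit (digits r x) * H x)
    ≡⟨ cong₂ _+_ (only-sum i L i<L) (digits-value r L beyond-r) ⟩
      H i + m ∎
    where
    open ≡-Reasoning
    -- H i is not a summand of r, so the digits of cons i r split into H i and those of r
    split : ∀ x → bit (digits (cons i k≤i r) x) * H x ≡ only i x + bit (digits r x) * H x
    split x with x ≟ i
    ... | no _     = refl
    ... | yes refl rewrite digits-below r x (s≤s (m≤n+m x d)) = refl
    beyond-r : ∀ x → L ≤ x → digits r x ≡ false
    beyond-r x L≤x with x ≟ i | beyond x L≤x
    ... | no _ | zero-digit = zero-digit
    -- i carries a digit, so it lies below L
    i<L : i < L
    i<L with i <? L
    ... | yes i<L = i<L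
    ... | no i≮L with i ≟ i | beyond i (≮⇒≥ i≮L)
    ...   | no i≢i | _ = ⊥-elim (i≢i refl)

  leastSummand : ∀ {j m} → RepWithLeast j m → LeastGSummand q m (H j)
  leastSummand {j} (x , r , m≡) =
    digits full ,
    (support full , digits-beyond full , window≤1 q (digits full) (digits-spaced full) ,
     trans (digits-value full (support full) (digits-beyond full)) (sym m≡)) ,
    j , least , below-j , refl
    where
    full : Rep 0 (H j + x)
    full = cons j z≤n r
    least : digits full j ≡ true
    least with j ≟ j
    ... | yes _  = refl
    ... | no j≢j = ⊥-elim (j≢j refl)
    below-j : ∀ y → y < j → digits full y ≡ false
    below-j y y<j with y ≟ j
    ... | yes refl = ⊥-elim (<-irrefl refl y<j)
    ... | no _     = digits-below r y (<-≤-trans y<j (m≤n+m j q))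

  respond : ∀ i p R → Rep (d + i) R → 1 ≤ p → p < H i →
            Σ ℕ λ j → RepWithLeast j (H i ∸ p + R) × (H j ≤ maxNext q p)
  respond i p R r p≥1 p<Hi with addBelow i (H i ∸ p) R r (m<n⇒0<n∸m p<Hi) (∸-monoʳ-< p≥1 (<⇒≤ p<Hi))
  ... | j , rep , bound = j , rep , ≤-trans (reply-enough j) (maxNext-mono H[j∸d]≤p)
    where
    H[j∸d]≤p : H (j ∸ d) ≤ p
    H[j∸d]≤p = +-cancelˡ-≤ (H i ∸ p) _ _
                 (≤-trans bound (≤-reflexive (sym (m∸n+n≡m (<⇒≤ p<Hi)))))

  WinsFrom : ℕ → Set
  WinsFrom m = ∀ k j → RepWithLeast j m → H j ≤ k → WinsByLeastSummand q m k

  winsFrom-step : ∀ m → (∀ {m'} → m' < m → WinsFrom m') → WinsFrom m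
  winsFrom-step m ih k j rep@(x , r , m≡) Hj≤k =
    play (H j) (leastSummand rep) (H-pos j) Hj≤k Hj≤m (reply r m≡)
    where
    Hj≤m : H j ≤ m
    Hj≤m = ≤-trans (m≤m+n (H j) x) (≤-reflexive (sym m≡))
    below-next : ∀ {i p} → q + j ≤ i → p ≤ maxNext q (H j) → p < H i
    below-next q+j≤i p≤max = ≤-<-trans p≤max (<-≤-trans (reply-short j) (H-mono q+j≤i))
    reply : ∀ {x} → Rep (q + j) x → m ≡ H j + x →
            ∀ p → 1 ≤ p → p ≤ maxNext q (H j) → p ≤ m ∸ H j →
            WinsByLeastSummand q (m ∸ H j ∸ p) (maxNext q p)
    reply nil m≡ p p≥1 _ p≤rest =
      ⊥-elim (<⇒≱ p≥1 (≤-trans p≤rest (≤-reflexive (trans (cong (_∸ H j) m≡) (m+n∸m≡n (H j) 0)))))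
    reply (cons {y} i q+j≤i r') m≡ p p≥1 p≤max _
      with respond i p y (Rep-weaken (n≤1+n (d + i)) r') p≥1 (below-next q+j≤i p≤max)
    ... | j' , rep' , Hj'≤ =
      subst (λ h → WinsByLeastSummand q h (maxNext q p)) (sym rest≡)
            (ih (subst (_< m) rest≡ rest<m) (maxNext q p) j' rep' Hj'≤)
      where
      p≤Hi : p ≤ H i
      p≤Hi = <⇒≤ (below-next q+j≤i p≤max)
      rest≡ : m ∸ H j ∸ p ≡ H i ∸ p + y
      rest≡ = trans (cong (λ h → h ∸ H j ∸ p) m≡)
                    (trans (cong (_∸ p) (m+n∸m≡n (H j) (H i + y))) (+-∸-comm y p≤Hi))
      rest<m : m ∸ H j ∸ p < m
      rest<m = ≤-<-trans (m∸n≤m _ p) (∸-monoʳ-< (H-pos j) Hj≤m)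

  winsFrom : ∀ m → WinsFrom m
  winsFrom = <-rec WinsFrom winsFrom-step

  -- A summand H i is lost for the player to move first: every move is answered by the strategy.
  summand-loses : ∀ i → Lose q (H i) (H i ∸ 1)
  summand-loses i = lose λ p p≥1 p≤ _ → leastSummand⇒Win (answer p p≥1 p≤)
    where
    answer : ∀ p → 1 ≤ p → p ≤ H i ∸ 1 → WinsByLeastSummand q (H i ∸ p) (maxNext q p)
    answer p p≥1 p≤ with respond i p 0 nil p≥1 (≤-<-trans p≤ (∸-monoʳ-< (s≤s z≤n) (H-pos i)))
    ... | j , rep , Hj≤ = winsFrom (H i ∸ p) (maxNext q p) j (subst (RepWithLeast j) (+-identityʳ _) rep) Hj≤

  -- For a non-G number the least summand is not the whole heap, hence a legal first move.
  nonG-wins : ∀ n → 1 ≤ n → ¬ IsGNumber q n → WinsByLeastSummand q n (n ∸ 1)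
  nonG-wins n n≥1 ¬G with represent n n≥1
  ... | j , (zero , _ , n≡) = ⊥-elim (¬G (q + q ∸ 2 + j , trans (sym (+-identityʳ (H j))) (sym n≡)))
  ... | j , rep@(suc x , _ , refl) =
    winsFrom _ _ j rep (subst (λ h → H j ≤ h ∸ 1) (sym (+-suc (H j) x)) (m≤m+n (H j) x))

  theorem : ∀ n → 1 ≤ n →
            (FirstPlayerWins q n ⇔ (¬ IsGNumber q n)) × ((¬ IsGNumber q n) → WinsByLeastSummand q n (n ∸ 1))
  theorem n n≥1 = mk⇔ (λ w isG → Win-Lose-disjoint w (G-loses isG)) (λ ¬G → leastSummand⇒Win (nonG-wins n n≥1 ¬G)) ,
                  nonG-wins n n≥1
    where
    G-loses : IsGNumber q n → Lose q n (n ∸ 1)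
    G-loses isG with G-summand n n≥1 isG
    ... | i , refl = summand-loses i

-- q = 1: H i = 2^i, and a player may at most repeat the previous move.
module Q1 where
  open Growth 0 (λ _ → refl) refl

  hypotheses : Hypotheses 0
  hypotheses = record
    { recurrence   = λ _ → refl
    ; start        = refl
    ; reply-short  = λ j → +-monoʳ-< (H j) (H-pos j)
    ; reply-enough = λ j → ≤-reflexive (sym (*-identityˡ (H j)))
    ; maxNext-mono = *-monoʳ-≤ 1
    ; G-summand    = λ _ _ isG → isG
    }

-- q = 2: H i are the Fibonacci numbers 1, 2, 3, 5, …
module Q2 where
  H : ℕ → ℕ
  H = Summand 1

  recurrence : ∀ i → H (suc i) ≡ H i + H (i ∸ 1)
  recurrence zero    = refl
  recurrence (suc i) = refl

  open Growth 1 recurrence refl using (H-<-suc; H-mono)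

  reply-short : ∀ j → 2 * H j < H (2 + j)
  reply-short j = subst₂ _<_ (cong (H j +_) (sym (+-identityʳ (H j)))) (sym (recurrence (suc j)))
                             (+-monoˡ-< (H j) (H-<-suc j))

  reply-enough : ∀ j → H j ≤ 2 * H (j ∸ 1)
  reply-enough zero    = s≤s z≤n
  reply-enough (suc k) = begin
    H (suc k)         ≡⟨ recurrence k ⟩
    H k + H (k ∸ 1)   ≤⟨ +-monoʳ-≤ (H k) (H-mono (m∸n≤m k 1)) ⟩
    H k + H k         ≡⟨ cong (H k +_) (sym (+-identityʳ (H k))) ⟩
    2 * H k           ∎
    where open ≤-Reasoning

  G-summand : ∀ n → 1 ≤ n → IsGNumber 2 n → Σ ℕ λ i → H i ≡ n
  G-summand n ()  (zero , refl)
  G-summand n _   (suc zero , G₁≡n) = 0 , G₁≡n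
  G-summand n _   (suc (suc k) , G≡n) = k , G≡n

  hypotheses : Hypotheses 1
  hypotheses = record
    { recurrence   = recurrence
    ; start        = refl
    ; reply-short  = reply-short
    ; reply-enough = reply-enough
    ; maxNext-mono = *-monoʳ-≤ 2
    ; G-summand    = G-summand
    }

-- q = 3: H i = 1, 2, 3, 4, 6, 9, 13, …, and after a move p ≥ 2 at most 3p - 1 beans may be taken.
module Q3 where
  H : ℕ → ℕ
  H = Summand 2

  recurrence : ∀ i → H (suc i) ≡ H i + H (i ∸ 2)
  recurrence zero          = refl
  recurrence (suc zero)    = refl
  recurrence (suc (suc i)) = refl

  open Growth 2 recurrence refl using (H-pos; H-<-suc; H-mono)

  maxNext≡ : ∀ x → 2 ≤ x → maxNext 3 x ≡ 3 * x ∸ 1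
  maxNext≡ (suc zero)    (s≤s ())
  maxNext≡ (suc (suc x)) _ = refl

  H≥2 : ∀ k → 2 ≤ H (suc k)
  H≥2 k = ≤-trans (s≤s (H-pos k)) (H-<-suc k)

  unfold3 : ∀ j → H (3 + j) ≡ H j + H (j ∸ 2) + H (j ∸ 1) + H j
  unfold3 j = begin
    H (3 + j)                           ≡⟨ recurrence (2 + j) ⟩
    H (2 + j) + H j                     ≡⟨ cong (_+ H j) (recurrence (suc j)) ⟩
    H (1 + j) + H (j ∸ 1) + H j         ≡⟨ cong (λ h → h + H (j ∸ 1) + H j) (recurrence j) ⟩
    H j + H (j ∸ 2) + H (j ∸ 1) + H j   ∎
    where open ≡-Reasoning

  H≤two-before : ∀ j → H j ≤ H (j ∸ 2) + H (j ∸ 1)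
  H≤two-before zero    = s≤s z≤n
  H≤two-before (suc k) = begin
    H (suc k)           ≡⟨ recurrence k ⟩
    H k + H (k ∸ 2)     ≤⟨ +-monoʳ-≤ (H k) (H-mono (∸-monoʳ-≤ k (s≤s (z≤n {1})))) ⟩
    H k + H (k ∸ 1)     ≡⟨ +-comm (H k) _ ⟩
    H (k ∸ 1) + H k     ∎
    where open ≤-Reasoning

  three-H≤ : ∀ j → 3 * H j ≤ H (3 + j)
  three-H≤ j = begin
    3 * H j                               ≡⟨ cong (λ h → H j + (H j + h)) (+-identityʳ (H j)) ⟩
    H j + (H j + H j)                     ≤⟨ +-monoʳ-≤ (H j) (+-monoˡ-≤ (H j) (H≤two-before j)) ⟩
    H j + (H (j ∸ 2) + H (j ∸ 1) + H j)   ≡⟨ sym (+-assoc (H j) _ (H j)) ⟩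
    H j + (H (j ∸ 2) + H (j ∸ 1)) + H j   ≡⟨ cong (_+ H j) (sym (+-assoc (H j) _ _)) ⟩
    H j + H (j ∸ 2) + H (j ∸ 1) + H j     ≡⟨ sym (unfold3 j) ⟩
    H (3 + j)                             ∎
    where open ≤-Reasoning

  reply-short : ∀ j → maxNext 3 (H j) < H (3 + j)
  reply-short zero    = ≤-refl
  reply-short (suc k) = begin-strict
    maxNext 3 (H (suc k))   ≡⟨ maxNext≡ (H (suc k)) (H≥2 k) ⟩
    3 * H (suc k) ∸ 1       <⟨ ∸-monoʳ-< (s≤s z≤n) (≤-trans (H-pos (suc k)) (m≤m+n _ _)) ⟩
    3 * H (suc k)           ≤⟨ three-H≤ (suc k) ⟩
    H (4 + k)               ∎
    where open ≤-Reasoning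

  reply-enough : ∀ j → H j ≤ maxNext 3 (H (j ∸ 2))
  reply-enough zero                = s≤s z≤n
  reply-enough (suc zero)          = s≤s (s≤s z≤n)
  reply-enough (suc (suc zero))    = ≤-refl
  reply-enough (suc (suc (suc k))) =
    subst (H (3 + k) ≤_) (sym (maxNext≡ a (H≥2 k))) (∸-monoˡ-≤ 1 H[3+k]<3a)
    where
    a = H (suc k)
    H[3+k]<3a : H (3 + k) < 3 * a
    H[3+k]<3a = begin-strict
      H (3 + k)               ≡⟨ recurrence (2 + k) ⟩
      H (2 + k) + H k         ≡⟨ cong (_+ H k) (recurrence (suc k)) ⟩
      a + H (k ∸ 1) + H k     ≡⟨ +-assoc a _ _ ⟩
      a + (H (k ∸ 1) + H k)   <⟨ +-monoʳ-< a (+-mono-≤-< (≤-trans (H-mono (m∸n≤m k 1)) (<⇒≤ (H-<-suc k))) (H-<-suc k)) ⟩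
      a + (a + a)             ≡⟨ cong (λ h → a + (a + h)) (sym (+-identityʳ a)) ⟩
      3 * a                   ∎
      where open ≤-Reasoning

  maxNext-mono : ∀ {a b} → a ≤ b → maxNext 3 a ≤ maxNext 3 b
  maxNext-mono {zero}                        _        = z≤n
  maxNext-mono {suc zero}    {suc zero}      _        = ≤-refl
  maxNext-mono {suc zero}    {suc (suc b)}   _        = s≤s (≤-trans (s≤s (s≤s z≤n)) (m≤n+m _ b))
  maxNext-mono {suc (suc a)} {suc zero}      (s≤s ())
  maxNext-mono {suc (suc a)} {suc (suc b)}   a≤b      = ∸-monoˡ-≤ 1 (*-monoʳ-≤ 3 a≤b)

  G-summand : ∀ n → 1 ≤ n → IsGNumber 3 n → Σ ℕ λ i → H i ≡ n
  G-summand n ()  (zero , refl)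
  G-summand n ()  (suc zero , refl)
  G-summand n _   (suc (suc zero) , G≡n)          = 0 , G≡n
  G-summand n _   (suc (suc (suc zero)) , G≡n)    = 0 , G≡n
  G-summand n _   (suc (suc (suc (suc k))) , G≡n) = k , G≡n

  hypotheses : Hypotheses 2
  hypotheses = record
    { recurrence   = recurrence
    ; start        = refl
    ; reply-short  = reply-short
    ; reply-enough = reply-enough
    ; maxNext-mono = maxNext-mono
    ; G-summand    = G-summand
    }

theorem5 : (q : ℕ) → 1 ≤ q → q ≤ 3 → (n : ℕ) → 1 ≤ n →
    (FirstPlayerWins q n ⇔ (¬ IsGNumber q n)) ×
    ((¬ IsGNumber q n) → WinsByLeastSummand q n (n ∸ 1))
theorem5 1 _ _ = Theory.theorem 0 Q1.hypotheses
theorem5 2 _ _ = Theory.theorem 1 Q2.hypotheses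
theorem5 3 _ _ = Theory.theorem 2 Q3.hypotheses
theorem5 (suc (suc (suc (suc _)))) _ (s≤s (s≤s (s≤s ())))
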